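{- Let $p\in\beta\mathbb N$. (a) If $p$ is right cancelable (i.e. $xp=yp$ implies $x=y$ for all $x,y\in\beta\mathbb N$), then $[p]_L=\{p\}$. (b) If $p$ is left cancelable (i.e. $px=py$ implies $x=y$ for all $x,y\in\beta\mathbb N$), then $[p]_R=\{p\}$.
   Context: $\mathbb N=\{1,2,3,\dots\}$; $\beta\mathbb N$ is the set of ultrafilters on $\mathbb N$, with each $n\in\mathbb N$ identified with the principal ultrafilter at $n$. Multiplication is extended to $\beta\mathbb N$ by: $A\in p\cdot q$ iff $\{n\in\mathbb N: A/n\in q\}\in p$, where $A/n=\{a/n: a\in A,\ n\mid a\}$. For $p,q\in\beta\mathbb N$: $p\mid_L q$ iff $q=rp$ for some $r\in\beta\mathbb N$; $p\mid_R q$ iff $q=pr$ for some $r\in\beta\mathbb N$. $p=_Lq$ means $p\mid_Lq$ and $q\mid_Lp$, and $[p]_L=\{q: q=_Lp\}$; similarly $=_R$ and $[p]_R$. -}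

module Defs where

open import Level using (0ℓ)
open import Data.Nat using (ℕ; suc; _*_; NonZero)
open import Data.Nat.Properties using (m*n≢0)
open import Data.Product using (Σ; _×_; _,_)
open import Data.Sum using (_⊎_; inj₁; inj₂)
open import Data.Empty using (⊥; ⊥-elim)
open import Relation.Nullary using (¬_)
open import Relation.Unary using (Pred; _⊆_; _∩_; ∅; ∁)
open import Function.Bundles using (_⇔_)

-- Subsets of ℕ (Agda's ℕ contains 0; the paper's ℕ = {1,2,...} is
-- modelled by requiring every ultrafilter to contain the set of
-- positive numbers, so these are exactly the ultrafilters on {1,2,...}).
Subset : Set₁
Subset = Pred ℕ 0ℓ

Positive : Subset
Positive n = NonZero n

record Ultrafilter : Set₁ where
  field
    mem      : Subset → Set
    upward   : ∀ {A B} → A ⊆ B → mem A → mem B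
    inter    : ∀ {A B} → mem A → mem B → mem (A ∩ B)
    proper   : ¬ mem ∅
    positive : mem Positive
    ultra    : ∀ A → mem A ⊎ mem (∁ A)

open Ultrafilter public

_≈_ : Ultrafilter → Ultrafilter → Set₁
p ≈ q = ∀ A → mem p A ⇔ mem q A

_/_ : Subset → ℕ → Subset
(A / n) m = A (n * m)

_·_ : Ultrafilter → Ultrafilter → Ultrafilter
mem (p · q) A = mem p (λ n → mem q (A / n))
upward (p · q) {A} {B} A⊆B =
  upward p {λ n → mem q (A / n)} {λ n → mem q (B / n)}
    (λ {n} → upward q {A / n} {B / n} (λ {m} x → A⊆B x))
inter (p · q) {A} {B} a b =
  upward p {(λ n → mem q (A / n)) ∩ (λ n → mem q (B / n))} {λ n → mem q ((A ∩ B) / n)}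
    (λ {n} (x , y) → inter q {A / n} {B / n} x y) (inter p a b)
proper (p · q) h = proper p (upward p {λ n → mem q (∅ / n)} {∅} (λ {n} x → proper q x) h)
positive (p · q) =
  upward p {Positive} {λ n → mem q (Positive / n)}
    (λ {n} nz → upward q {Positive} {Positive / n} (λ {m} mz → m*n≢0 n m {{nz}} {{mz}}) (positive q))
    (positive p)
ultra (p · q) A with ultra p (λ n → mem q (A / n))
... | inj₁ x = inj₁ x
... | inj₂ x = inj₂ (upward p {∁ (λ n → mem q (A / n))} {λ n → mem q (∁ A / n)} (λ {n} → f {n}) x)
  where
  f : ∀ {n} → ¬ mem q (A / n) → mem q (∁ A / n)
  f {n} nq with ultra q (A / n)
  ... | inj₁ y = ⊥-elim (nq y)
  ... | inj₂ y = y

_∣L_ : Ultrafilter → Ultrafilter → Set₁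
p ∣L q = Σ Ultrafilter (λ r → q ≈ (r · p))

_∣R_ : Ultrafilter → Ultrafilter → Set₁
p ∣R q = Σ Ultrafilter (λ r → q ≈ (p · r))

_=L_ : Ultrafilter → Ultrafilter → Set₁
p =L q = p ∣L q × q ∣L p

_=R_ : Ultrafilter → Ultrafilter → Set₁
p =R q = p ∣R q × q ∣R p

[_]L : Ultrafilter → Ultrafilter → Set₁
[ p ]L q = q =L p

[_]R : Ultrafilter → Ultrafilter → Set₁
[ p ]R q = q =R p

RightCancelable : Ultrafilter → Set₁
RightCancelable p = ∀ x y → (x · p) ≈ (y · p) → x ≈ y

LeftCancelable : Ultrafilter → Set₁
LeftCancelable p = ∀ x y → (p · x) ≈ (p · y) → x ≈ y

-- Any ultrafilter e with {1} ∈ e is a two-sided identity, and {1} ∈ s · r forces {1} ∈ s and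
-- {1} ∈ r.  If q = s p and p = r q, then (r s) p = p = e p, so right cancelability of p gives
-- r s = e; hence {1} ∈ s and q = s p = p.  Part (b) is the mirror image.
module Submission where

open import Level using (0ℓ) renaming (suc to lsuc)
open import Data.Nat using (ℕ; _*_)
open import Data.Nat.Properties
  using (*-assoc; *-identityˡ; *-identityʳ; m*n≡1⇒m≡1; m*n≡1⇒n≡1)
open import Data.Product using (_×_; _,_)
open import Data.Sum using (inj₁; inj₂)
open import Data.Empty using (⊥-elim)
open import Function.Bundles using (_⇔_; mk⇔; Equivalence)
import Function.Properties.Equivalence as ⇔
open import Relation.Nullary using (¬_)
open import Relation.Unary using (｛_｝; _⊆_)
open import Relation.Binary.Bundles using (Setoid)
open import Relation.Binary.Structures using (IsEquivalence)
open import Relation.Binary.PropositionalEquality using (_≡_; refl; sym; subst)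
import Relation.Binary.Reasoning.Setoid as SetoidReasoning

open import Defs

open Equivalence using (to; from)

≈-isEquivalence : IsEquivalence _≈_
≈-isEquivalence = record
  { refl  = λ A → ⇔.refl
  ; sym   = λ e A → ⇔.sym (e A)
  ; trans = λ e f A → ⇔.trans (e A) (f A)
  }

≈-setoid : Setoid (lsuc 0ℓ) (lsuc 0ℓ)
≈-setoid = record { isEquivalence = ≈-isEquivalence }

open IsEquivalence ≈-isEquivalence using () renaming (sym to ≈-sym)

module _ (u : Ultrafilter) where

  mem⇒nonempty : ∀ {A} → mem u A → ¬ (∀ {n} → ¬ A n)
  mem⇒nonempty h empty = proper u (upward u empty h)

  upward-¬¬ : ∀ {X A} → (X ⊆ λ n → ¬ ¬ A n) → mem u X → mem u A
  upward-¬¬ {A = A} X⊆¬¬A h with ultra u A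
  ... | inj₁ a  = a
  ... | inj₂ ¬a = ⊥-elim (mem⇒nonempty (inter u h ¬a) (λ (x , y) → X⊆¬¬A x y))

  mem-stable : ∀ {A} → ¬ ¬ mem u A → mem u A
  mem-stable {A} ¬¬a with ultra u A
  ... | inj₁ a  = a
  ... | inj₂ ¬a = ⊥-elim (¬¬a λ a → mem⇒nonempty (inter u a ¬a) (λ (x , y) → y x))

  mem-const : ∀ {P : Set} → mem u (λ _ → P) → ¬ ¬ P
  mem-const h ¬P = mem⇒nonempty h ¬P

  upward-subst : ∀ {A : Subset} {f g : ℕ → ℕ} → (∀ n → f n ≡ g n) →
                 mem u (λ n → A (f n)) → mem u (λ n → A (g n))
  upward-subst {A} f≗g = upward u (λ {n} → subst A (f≗g n))

·-congˡ : ∀ s q q′ → q ≈ q′ → (s · q) ≈ (s · q′)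
·-congˡ s q q′ e A = mk⇔
  (upward s λ {n} → to (e (A / n)))
  (upward s λ {n} → from (e (A / n)))

·-congʳ : ∀ q q′ r → q ≈ q′ → (q · r) ≈ (q′ · r)
·-congʳ q q′ r e A = e (λ n → mem r (A / n))

·-assoc : ∀ s r p → ((s · r) · p) ≈ (s · (r · p))
·-assoc s r p A = mk⇔
  (upward s λ {n} → upward r λ {m} → upward-subst p {A} (λ k → *-assoc n m k))
  (upward s λ {n} → upward r λ {m} → upward-subst p {A} (λ k → sym (*-assoc n m k)))

IsOne : Ultrafilter → Set
IsOne r = mem r ｛ 1 ｝

oneˡ : ∀ r p → IsOne r → (r · p) ≈ p
oneˡ r p r∋1 A = mk⇔
  (λ h → mem-stable p (mem-const r (upward r
    (λ { (A/1∈p , refl) → upward-subst p {A} *-identityˡ A/1∈p }) (inter r h r∋1))))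
  (λ A∈p → upward r
    (λ { refl → upward-subst p {A} (λ m → sym (*-identityˡ m)) A∈p }) r∋1)

oneʳ : ∀ p r → IsOne r → (p · r) ≈ p
oneʳ p r r∋1 A = mk⇔
  (upward-¬¬ p λ {n} A/n∈r → mem-const r (upward r
    (λ { (a , refl) → subst A (*-identityʳ n) a }) (inter r A/n∈r r∋1)))
  (upward p λ {n} a → upward r (λ { refl → subst A (sym (*-identityʳ n)) a }) r∋1)

-- The principal ultrafilter at 1 cannot be defined outright, since `ultra` would have to decide
-- A 1 for every A; instead the decision is borrowed from an arbitrary ultrafilter u.
unit : Ultrafilter → Ultrafilter
mem (unit u) A = mem u (λ _ → A 1)
upward (unit u) A⊆B = upward u A⊆B
inter (unit u) a b = inter u a b
proper (unit u) h = proper u h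
positive (unit u) = upward u (λ _ → _) (positive u)
ultra (unit u) A = ultra u (λ _ → A 1)

IsOne-unit : ∀ u → IsOne (unit u)
IsOne-unit u = upward u (λ _ → refl) (positive u)

IsOne-·ˡ : ∀ s r → IsOne (s · r) → IsOne s
IsOne-·ˡ s r = upward-¬¬ s λ {n} 1/n∈r 1≢n →
  mem⇒nonempty r 1/n∈r (λ {m} 1≡nm → 1≢n (sym (m*n≡1⇒m≡1 n m (sym 1≡nm))))

IsOne-·ʳ : ∀ s r → IsOne (s · r) → IsOne r
IsOne-·ʳ s r h = mem-stable r (mem-const s (upward s
  (λ {n} → upward r λ {m} 1≡nm → sym (m*n≡1⇒n≡1 n m (sym 1≡nm))) h))

module _ (p : Ultrafilter) where
  open SetoidReasoning ≈-setoid

  ≈⇒∣L : ∀ q → p ≈ q → p ∣L q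
  ≈⇒∣L q p≈q = unit p , (begin
    q           ≈⟨ p≈q ⟨
    p           ≈⟨ oneˡ (unit p) p (IsOne-unit p) ⟨
    unit p · p  ∎)

  ≈⇒∣R : ∀ q → p ≈ q → p ∣R q
  ≈⇒∣R q p≈q = unit p , (begin
    q           ≈⟨ p≈q ⟨
    p           ≈⟨ oneʳ p (unit p) (IsOne-unit p) ⟨
    p · unit p  ∎)

  =L⇒≈ : ∀ q → RightCancelable p → q =L p → q ≈ p
  =L⇒≈ q cancel ((r , p≈rq) , (s , q≈sp)) = begin
    q      ≈⟨ q≈sp ⟩
    s · p  ≈⟨ oneˡ s p (IsOne-·ʳ r s (from (rs≈unit ｛ 1 ｝) (IsOne-unit p))) ⟩
    p      ∎
    where
    rs≈unit : (r · s) ≈ unit p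
    rs≈unit = cancel (r · s) (unit p) (begin
      (r · s) · p  ≈⟨ ·-assoc r s p ⟩
      r · (s · p)  ≈⟨ ·-congˡ r q (s · p) q≈sp ⟨
      r · q        ≈⟨ p≈rq ⟨
      p            ≈⟨ oneˡ (unit p) p (IsOne-unit p) ⟨
      unit p · p   ∎)

  =R⇒≈ : ∀ q → LeftCancelable p → q =R p → q ≈ p
  =R⇒≈ q cancel ((r , p≈qr) , (s , q≈ps)) = begin
    q      ≈⟨ q≈ps ⟩
    p · s  ≈⟨ oneʳ p s (IsOne-·ˡ s r (from (sr≈unit ｛ 1 ｝) (IsOne-unit p))) ⟩
    p      ∎
    where
    sr≈unit : (s · r) ≈ unit p
    sr≈unit = cancel (s · r) (unit p) (begin
      p · (s · r)  ≈⟨ ·-assoc p s r ⟨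
      (p · s) · r  ≈⟨ ·-congʳ q (p · s) r q≈ps ⟨
      q · r        ≈⟨ p≈qr ⟨
      p            ≈⟨ oneʳ p (unit p) (IsOne-unit p) ⟨
      p · unit p   ∎)

≈⇒=L : ∀ p q → q ≈ p → q =L p
≈⇒=L p q q≈p = ≈⇒∣L q p q≈p , ≈⇒∣L p q (≈-sym {q} {p} q≈p)

≈⇒=R : ∀ p q → q ≈ p → q =R p
≈⇒=R p q q≈p = ≈⇒∣R q p q≈p , ≈⇒∣R p q (≈-sym {q} {p} q≈p)

mainTheorem1 : (p : Ultrafilter) →
    (RightCancelable p → ∀ q → ([ p ]L q ⇔ q ≈ p)) ×
    (LeftCancelable p → ∀ q → ([ p ]R q ⇔ q ≈ p))
mainTheorem1 p =
  (λ cancel q → mk⇔ (=L⇒≈ p q cancel) (≈⇒=L p q)) ,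
  (λ cancel q → mk⇔ (=R⇒≈ p q cancel) (≈⇒=R p q))
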